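{- For $k\geq 2$ let $f_k(n)=pp_k(n)-pp_k(n-1)$. Then: (1) $f_k(0)=1$ and $f_k(1)=-1$. (2) $f_2(n)\geq 0$ if and only if $n$ is even; moreover $f_2(n)=-\lceil n/6\rceil$ when $n$ is odd. (3) $f_3(n)\geq 0$ for all $n\geq 2$ with $n\neq 7$; moreover $f_3(n)\geq (n-15)/2$ when $n$ is odd and $n\geq 17$. (4) For $k\geq 4$, $f_k(n)\geq 0$ for all $n\geq 2$; moreover $f_k(2k+7)\geq 1$.
   Context: For $k\geq 2$, $pp_k(n)$ is defined by \[\sum_{n\geq 0}pp_k(n)q^n=\frac{1}{(q^2;q)_{k-1}(q^2;q)_k},\qquad (a;q)_j=\prod_{i=0}^{j-1}(1-aq^i),\] and $pp_k(n)=0$ for $n<0$. Combinatorially, $pp_k(n)$ counts pairs $(\alpha,\beta)$ where for some $0\leq i\leq n$, $\alpha$ is a partition of $i$ with at most $k$ parts whose largest part appears at least twice (or empty) and $\beta$ is a partition of $n-i$ with at most $k+1$ parts whose largest part appears at least twice (or empty). Statements concern nonnegative integers $n$. -}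

module Defs where

open import Data.Nat using (ℕ; zero; suc; _+_; _*_; _∸_; _/_)
open import Data.Nat.Divisibility using (_∣?_)
open import Data.List using (List; []; _∷_; upTo; map)
open import Data.Nat.ListAction using (sum)
open import Data.Integer as ℤ using (ℤ; +_; _-_)
open import Relation.Nullary using (yes; no)

-- coefficient of q^i in 1/(1 - q^a) : 1 if a ∣ i, else 0
geomCoeff : ℕ → ℕ → ℕ
geomCoeff a i with a ∣? i
... | yes _ = 1
... | no  _ = 0

-- coefficient of q^n in  ∏_{a ∈ as} 1/(1 - q^a)   (Cauchy product of power series)
coeffProdInv : List ℕ → ℕ → ℕ
coeffProdInv []       zero    = 1
coeffProdInv []       (suc _) = 0
coeffProdInv (a ∷ as) n = sum (map (λ i → geomCoeff a i * coeffProdInv as (n ∸ i)) (upTo (suc n)))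

from2to : ℕ → List ℕ
from2to zero          = []
from2to (suc zero)    = []
from2to (suc (suc m)) = go (suc m)
  where
  go : ℕ → List ℕ
  go zero    = []
  go (suc j) = suc (suc j) ∷ go j

-- (q^2;q)_{k-1} = ∏_{j=2}^{k} (1 - q^j),   (q^2;q)_k = ∏_{j=2}^{k+1} (1 - q^j)
-- sum_n pp k n q^n = 1 / ((q^2;q)_{k-1} (q^2;q)_k)
pp : ℕ → ℕ → ℕ
pp k n = coeffProdInv (from2to k Data.List.++ from2to (suc k)) n

-- f_k(n) = pp_k(n) - pp_k(n-1), with pp_k(-1) = 0
f : ℕ → ℕ → ℤ
f k zero    = + pp k zero
f k (suc n) = + pp k (suc n) - + pp k n

ceil/6 : ℕ → ℕ
ceil/6 n = (n + 5) / 6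

-- pp (k + 1) = pp k / ((1 − q^(k+1)) (1 − q^(k+2))), and X = c / (1 − q^a) is the coefficient
-- recurrence X n = c n + X (n − a). Through it, "nondecreasing from 1 and increasing from 5"
-- passes from pp k to pp (k + 1) when k ≥ 4: the only descent of q^a X is the drop from X 0 = 1
-- to X 1 = 0, and it is outweighed by the strict increase of c at the same place. The base
-- case k = 4 and the cases k = 2, 3 reduce to finitely many computed coefficients through the
-- periodicities f₂ (n + 6) = f₂ n + (2 or −1, as n is even or odd) and
-- f₃ (n + 13) = f₃ (n + 1) + D n, where D n ≥ 6 for n ≥ 16.

module Submission where

open import Defs
open import Data.Nat
open import Data.Nat.Properties
open import Data.Nat.Divisibility
open import Data.Nat.DivMod using (m/n≡1+[m∸n]/n; m≥n⇒m/n>0; m/n*n≤m; /-monoˡ-≤)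
open import Data.Nat.Induction using (<-rec)
open import Data.Nat.ListAction using (sum)
open import Data.Nat.Tactic.RingSolver using (solve-∀)
open import Data.Integer as ℤ using (ℤ; +_; -_; _-_)
import Data.Integer.Properties as ℤ
open import Data.Integer.Tactic.RingSolver using () renaming (solve-∀ to ℤ-solve-∀)
open import Data.List using ([]; _∷_; _++_; applyUpTo)
open import Data.List.Properties using (map-applyUpTo)
open import Data.List.Relation.Unary.All as All using (All; []; _∷_)
open import Data.List.Relation.Unary.All.Properties using (++⁺)
open import Data.Product using (_×_; _,_; proj₁; proj₂; uncurry)
open import Data.Empty using (⊥-elim)
open import Function using (_∘_)
open import Function.Bundles using (_⇔_; mk⇔)
open import Relation.Binary.PropositionalEquality
open import Relation.Nullary using (¬_; yes; no)
open import Relation.Nullary.Decidable using (True; toWitness; _→-dec_; ¬?; decidable-stable)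
open import Relation.Unary using (Decidable)

≤-split : ∀ (P : ℕ → Set) b → (∀ m → P (b + m)) → ∀ {n} → b ≤ n → P n
≤-split P b above b≤n = subst P (m+[n∸m]≡n b≤n) (above _)

<-split : ∀ (P : ℕ → Set) b → (∀ {n} → n < b → P n) → (∀ m → P (b + m)) → ∀ n → P n
<-split P b below above n with n <? b
... | yes n<b = below n<b
... | no n≮b  = ≤-split P b above (≮⇒≥ n≮b)

periodic-induction : ∀ (P : ℕ → Set) {s} lo → 1 ≤ s → (∀ {n} → lo ≤ n → n < lo + s → P n) →
  (∀ {n} → lo ≤ n → P n → P (s + n)) → ∀ {n} → lo ≤ n → P n
periodic-induction P {s} lo 1≤s base step {n} = <-rec (λ n → lo ≤ n → P n) go n
  where
  go : ∀ n → (∀ {m} → m < n → lo ≤ m → P m) → lo ≤ n → P n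
  go n ih lo≤n with n <? lo + s
  ... | yes n<lo+s = base lo≤n n<lo+s
  ... | no n≮lo+s  = subst P (m+[n∸m]≡n s≤n) (step lo≤n∸s (ih (∸-monoʳ-< 1≤s s≤n) lo≤n∸s))
    where
    s≤n : s ≤ n
    s≤n = ≤-trans (m≤n+m s lo) (≮⇒≥ n≮lo+s)
    lo≤n∸s : lo ≤ n ∸ s
    lo≤n∸s = m+n≤o⇒m≤o∸n lo (≮⇒≥ n≮lo+s)

byComputation : ∀ {P : ℕ → Set} (P? : Decidable P) lo len →
  {True (allUpTo? (λ m → P? (lo + m)) len)} → ∀ {n} → lo ≤ n → n < lo + len → P n
byComputation {P} P? lo len {ok} =
  ≤-split (λ n → n < lo + len → P n) lo (λ m lo+m<lo+len → toWitness ok (+-cancelˡ-< lo m len lo+m<lo+len))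

-- Power series

-- Coefficients of q^a F.
shift : ℕ → (ℕ → ℕ) → ℕ → ℕ
shift zero    F n       = F n
shift (suc a) F zero    = 0
shift (suc a) F (suc n) = shift a F n

shift-+ : ∀ a F n → shift a F (a + n) ≡ F n
shift-+ zero    F n = refl
shift-+ (suc a) F n = shift-+ a F n

shift-< : ∀ {a} F {n} → n < a → shift a F n ≡ 0
shift-< {suc a} F {zero}  _         = refl
shift-< {suc a} F {suc n} (s≤s n<a) = shift-< F n<a

shift-shift : ∀ a b F n → shift a (shift b F) n ≡ shift (a + b) F n
shift-shift zero    b F n       = refl
shift-shift (suc a) b F zero    = refl
shift-shift (suc a) b F (suc n) = shift-shift a b F n

shift-comm : ∀ a b F n → shift a (shift b F) n ≡ shift b (shift a F) n
shift-comm a b F n = begin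
  shift a (shift b F) n ≡⟨ shift-shift a b F n ⟩
  shift (a + b) F n     ≡⟨ cong (λ c → shift c F n) (+-comm a b) ⟩
  shift (b + a) F n     ≡⟨ shift-shift b a F n ⟨
  shift b (shift a F) n ∎
  where open ≡-Reasoning

shift-cong : ∀ a {F G} n → (∀ m → a + m ≤ n → F m ≡ G m) → shift a F n ≡ shift a G n
shift-cong zero    n       F≡G = F≡G n ≤-refl
shift-cong (suc a) zero    F≡G = refl
shift-cong (suc a) (suc n) F≡G = shift-cong a n (λ m a+m≤n → F≡G m (s≤s a+m≤n))

shift-distrib-+ : ∀ a F G n → shift a (λ m → F m + G m) n ≡ shift a F n + shift a G n
shift-distrib-+ zero    F G n       = refl
shift-distrib-+ (suc a) F G zero    = refl
shift-distrib-+ (suc a) F G (suc n) = shift-distrib-+ a F G n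

-- Cauchy product, written exactly as the sums in coeffProdInv.
conv : (ℕ → ℕ) → (ℕ → ℕ) → ℕ → ℕ
conv w c n = sum (applyUpTo (λ i → w i * c (n ∸ i)) (suc n))

coeffProdInv-conv : ∀ a l n → coeffProdInv (a ∷ l) n ≡ conv (geomCoeff a) (coeffProdInv l) n
coeffProdInv-conv a l n = cong sum (map-applyUpTo (λ i → i) _ (suc n))

conv-cong : ∀ {v w} c → (∀ i → v i ≡ w i) → ∀ n → conv v c n ≡ conv w c n
conv-cong c v≡w zero    = cong (λ x → x * c 0 + 0) (v≡w 0)
conv-cong c v≡w (suc n) = cong₂ (λ x y → x * c (suc n) + y) (v≡w 0) (conv-cong c (v≡w ∘ suc) n)

private
  distribʳ-step : ∀ x y z s t → (x + y) * z + (s + t) ≡ (x * z + s) + (y * z + t)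
  distribʳ-step = solve-∀

conv-distribʳ-+ : ∀ v w c n → conv (λ i → v i + w i) c n ≡ conv v c n + conv w c n
conv-distribʳ-+ v w c zero    = distribʳ-step (v 0) (w 0) (c 0) 0 0
conv-distribʳ-+ v w c (suc n) =
  trans (cong (_+_ ((v 0 + w 0) * c (suc n))) (conv-distribʳ-+ (v ∘ suc) (w ∘ suc) c n))
        (distribʳ-step (v 0) (w 0) (c (suc n)) _ _)

-- The series 1, as the empty product so that it agrees definitionally with coeffProdInv [].
one : ℕ → ℕ
one = coeffProdInv []

conv-zeroˡ : ∀ c n → conv (λ _ → 0) c n ≡ 0
conv-zeroˡ c zero    = refl
conv-zeroˡ c (suc n) = conv-zeroˡ c n

conv-identityˡ : ∀ c n → conv one c n ≡ c n
conv-identityˡ c zero    = trans (+-identityʳ _) (*-identityˡ (c 0))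
conv-identityˡ c (suc n) = trans (cong (_+_ (1 * c (suc n))) (conv-zeroˡ c n))
                                 (trans (+-identityʳ _) (*-identityˡ (c (suc n))))

conv-identityʳ : ∀ w n → conv w one n ≡ w n
conv-identityʳ w zero    = trans (+-identityʳ _) (*-identityʳ (w 0))
conv-identityʳ w (suc n) = trans (cong (_+ conv (w ∘ suc) one n) (*-zeroʳ (w 0))) (conv-identityʳ (w ∘ suc) n)

conv-shiftˡ : ∀ a w c n → conv (shift a w) c n ≡ shift a (conv w c) n
conv-shiftˡ zero    w c n       = refl
conv-shiftˡ (suc a) w c zero    = refl
conv-shiftˡ (suc a) w c (suc n) = conv-shiftˡ a w c n

geomCoeff-∣ : ∀ {a i} → a ∣ i → geomCoeff a i ≡ 1
geomCoeff-∣ {a} {i} a∣i with a ∣? i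
... | yes _  = refl
... | no a∤i = ⊥-elim (a∤i a∣i)

geomCoeff-∤ : ∀ {a i} → ¬ a ∣ i → geomCoeff a i ≡ 0
geomCoeff-∤ {a} {i} a∤i with a ∣? i
... | yes a∣i = ⊥-elim (a∤i a∣i)
... | no _    = refl

geomCoeff-unfold : ∀ {a} → 1 ≤ a → ∀ i → geomCoeff a i ≡ one i + shift a (geomCoeff a) i
geomCoeff-unfold {a} (s≤s z≤n) i with i <? a
... | yes i<a = trans (below i i<a) (sym (trans (cong (_+_ (one i)) (shift-< (geomCoeff a) i<a)) (+-identityʳ _)))
  where
  below : ∀ i → i < a → geomCoeff a i ≡ one i
  below zero    _   = geomCoeff-∣ (a ∣0)
  below (suc i) i<a = geomCoeff-∤ (λ a∣i → <⇒≱ i<a (∣⇒≤ a∣i))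
... | no i≮a = begin
  geomCoeff a i                            ≡⟨ cong (geomCoeff a) i≡a+j ⟩
  geomCoeff a (a + j)                      ≡⟨ period ⟩
  geomCoeff a j                            ≡⟨ shift-+ a (geomCoeff a) j ⟨
  shift a (geomCoeff a) (a + j)            ≡⟨⟩
  one (a + j) + shift a (geomCoeff a) (a + j) ≡⟨ cong (λ m → one m + shift a (geomCoeff a) m) i≡a+j ⟨
  one i + shift a (geomCoeff a) i          ∎
  where
  open ≡-Reasoning
  j = i ∸ a
  i≡a+j : i ≡ a + j
  i≡a+j = sym (m+[n∸m]≡n (≮⇒≥ i≮a))
  period : geomCoeff a (a + j) ≡ geomCoeff a j
  period with a ∣? j
  ... | yes a∣j = geomCoeff-∣ (∣m∣n⇒∣m+n ∣-refl a∣j)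
  ... | no a∤j  = geomCoeff-∤ (λ a∣a+j → a∤j (∣m+n∣m⇒∣n a∣a+j ∣-refl))

-- X = c/(1 − q^a), in the form X = c + q^a X.
record GeomQuotient (a : ℕ) (c X : ℕ → ℕ) : Set where
  constructor geomQuotient
  field unfold : ∀ n → X n ≡ c n + shift a X n
open GeomQuotient public

module _ {a c X} (X=c/[1-qᵃ] : GeomQuotient a c X) where

  geomQuotient-< : ∀ {n} → n < a → X n ≡ c n
  geomQuotient-< {n} n<a = trans (unfold X=c/[1-qᵃ] n) (trans (cong (_+_ (c n)) (shift-< X n<a)) (+-identityʳ _))

  geomQuotient-+ : ∀ n → X (a + n) ≡ c (a + n) + X n
  geomQuotient-+ n = trans (unfold X=c/[1-qᵃ] (a + n)) (cong (_+_ (c (a + n))) (shift-+ a X n))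

  geomQuotient-+ʳ : ∀ n → X (n + a) ≡ c (n + a) + X n
  geomQuotient-+ʳ n = subst (λ m → X m ≡ c m + X n) (+-comm a n) (geomQuotient-+ n)

geomQuotient-∷ : ∀ {a} → 1 ≤ a → ∀ l → GeomQuotient a (coeffProdInv l) (coeffProdInv (a ∷ l))
geomQuotient-∷ {a} 1≤a l = geomQuotient λ n → begin
  P n                                             ≡⟨ coeffProdInv-conv a l n ⟩
  conv g c n                                      ≡⟨ conv-cong c (geomCoeff-unfold 1≤a) n ⟩
  conv (λ i → one i + shift a g i) c n            ≡⟨ conv-distribʳ-+ one (shift a g) c n ⟩
  conv one c n + conv (shift a g) c n             ≡⟨ cong₂ _+_ (conv-identityˡ c n) (conv-shiftˡ a g c n) ⟩
  c n + shift a (conv g c) n                      ≡⟨ cong (_+_ (c n)) (shift-cong a n (λ m _ → coeffProdInv-conv a l m)) ⟨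
  c n + shift a P n                               ∎
  where
  open ≡-Reasoning
  P = coeffProdInv (a ∷ l)
  c = coeffProdInv l
  g = geomCoeff a

geomQuotient-swap : ∀ {a b C Z X Y} → 1 ≤ b →
  GeomQuotient a C Z → GeomQuotient b C X → GeomQuotient b Z Y → GeomQuotient a X Y
geomQuotient-swap {a} {b} {C} {Z} {X} {Y} 1≤b Z=C/a X=C/b Y=Z/b = geomQuotient (<-rec _ step)
  where
  open ≡-Reasoning
  -- Y (1 − q^a)(1 − q^b) = C, written without subtraction
  product : ∀ n → Y n + shift a (shift b Y) n ≡ C n + shift a Y n + shift b Y n
  product n = begin
    Y n + shift a (shift b Y) n
      ≡⟨ cong (_+ shift a (shift b Y) n) (trans (unfold Y=Z/b n) (cong (_+ shift b Y n) (unfold Z=C/a n))) ⟩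
    C n + shift a Z n + shift b Y n + shift a (shift b Y) n
      ≡⟨ rearrange (C n) (shift a Z n) (shift b Y n) (shift a (shift b Y) n) ⟩
    C n + (shift a Z n + shift a (shift b Y) n) + shift b Y n
      ≡⟨ cong (λ s → C n + s + shift b Y n) (shift-distrib-+ a Z (shift b Y) n) ⟨
    C n + shift a (λ m → Z m + shift b Y m) n + shift b Y n
      ≡⟨ cong (λ s → C n + s + shift b Y n) (shift-cong a n (λ m _ → unfold Y=Z/b m)) ⟨
    C n + shift a Y n + shift b Y n ∎
    where
    rearrange : ∀ x y z t → x + y + z + t ≡ x + (y + t) + z
    rearrange = solve-∀
  step : ∀ n → (∀ {m} → m < n → Y m ≡ X m + shift a Y m) → Y n ≡ X n + shift a Y n
  step n ih = +-cancelʳ-≡ (shift a (shift b Y) n) _ _ (begin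
    Y n + S                                                ≡⟨ product n ⟩
    C n + shift a Y n + shift b Y n                        ≡⟨ cong (_+_ (C n + shift a Y n)) shift-ih ⟩
    C n + shift a Y n + (shift b X n + shift b (shift a Y) n)
      ≡⟨ cong (λ s → C n + shift a Y n + (shift b X n + s)) (shift-comm b a Y n) ⟩
    C n + shift a Y n + (shift b X n + S)                  ≡⟨ rearrange (C n) (shift a Y n) (shift b X n) S ⟩
    (C n + shift b X n) + shift a Y n + S                  ≡⟨ cong (λ x → x + shift a Y n + S) (unfold X=C/b n) ⟨
    X n + shift a Y n + S                                  ∎)
    where
    S = shift a (shift b Y) n
    shift-ih : shift b Y n ≡ shift b X n + shift b (shift a Y) n
    shift-ih = trans (shift-cong b n (λ m b+m≤n → ih (<-≤-trans (m<n+m m 1≤b) b+m≤n)))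
                     (shift-distrib-+ b X (shift a Y) n)
    rearrange : ∀ x y z t → x + y + (z + t) ≡ x + z + y + t
    rearrange = solve-∀

geomQuotient-insert : ∀ {a} → 1 ≤ a → ∀ {xs} → All (1 ≤_) xs → ∀ ys →
  GeomQuotient a (coeffProdInv (xs ++ ys)) (coeffProdInv (xs ++ a ∷ ys))
geomQuotient-insert 1≤a []                      ys = geomQuotient-∷ 1≤a ys
geomQuotient-insert {a} 1≤a {x ∷ xs} (1≤x ∷ 1≤xs) ys =
  geomQuotient-swap {a} 1≤x (geomQuotient-insert 1≤a 1≤xs ys)
    (geomQuotient-∷ 1≤x (xs ++ ys)) (geomQuotient-∷ 1≤x (xs ++ _ ∷ ys))

coeffProdInv-[_] : ∀ a n → coeffProdInv (a ∷ []) n ≡ geomCoeff a n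
coeffProdInv-[ a ] n = trans (coeffProdInv-conv a [] n) (conv-identityʳ (geomCoeff a) n)

coeffProdInv-below : ∀ {n} l → All (n <_) l → coeffProdInv l n ≡ one n
coeffProdInv-below []      []             = refl
coeffProdInv-below (a ∷ l) (n<a ∷ n<l) =
  trans (geomQuotient-< (geomQuotient-∷ (<-≤-trans (s≤s z≤n) n<a) l) n<a) (coeffProdInv-below l n<l)

-- Monotonicity of quotients

NondecreasingFrom IncreasingFrom : ℕ → (ℕ → ℕ) → Set
NondecreasingFrom N g = ∀ {n} → N ≤ n → g n ≤ g (suc n)
IncreasingFrom    N g = ∀ {n} → N ≤ n → g n < g (suc n)

-- n ≢ a excludes the step from h 0 to h 1, which is a descent for all series considered here.
shift-mono : ∀ a {h} n → (∀ {m} → 1 ≤ m → a + m ≤ n → h m ≤ h (suc m)) → n ≢ a →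
  shift a h n ≤ shift a h (suc n)
shift-mono zero    zero    _    0≢0 = ⊥-elim (0≢0 refl)
shift-mono zero    (suc n) mono _   = mono (s≤s z≤n) ≤-refl
shift-mono (suc a) zero    _    _   = z≤n
shift-mono (suc a) (suc n) mono n≢a = shift-mono a n (λ 1≤m a+m≤n → mono 1≤m (s≤s a+m≤n)) (n≢a ∘ cong suc)

module _ {a g h} (h=g/[1-qᵃ] : GeomQuotient a g h) where

  quotient-mono-at : ∀ {n} → (∀ {m} → 1 ≤ m → a + m ≤ n → h m ≤ h (suc m)) → n ≢ a →
    g n ≤ g (suc n) → h n ≤ h (suc n)
  quotient-mono-at {n} mono n≢a g≤ = subst₂ _≤_ (sym (unfold h=g/[1-qᵃ] n)) (sym (unfold h=g/[1-qᵃ] (suc n)))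
    (+-mono-≤ g≤ (shift-mono a n mono n≢a))

  quotient-increasing-at : ∀ {n} → NondecreasingFrom 1 h → n ≢ a → g n < g (suc n) → h n < h (suc n)
  quotient-increasing-at {n} mono n≢a g< = subst₂ _<_ (sym (unfold h=g/[1-qᵃ] n)) (sym (unfold h=g/[1-qᵃ] (suc n)))
    (+-mono-<-≤ g< (shift-mono a n (λ 1≤m _ → mono 1≤m) n≢a))

  quotient-monotone : 1 ≤ a → h 0 ≡ 1 → h 1 ≡ 0 → NondecreasingFrom 1 g → g a < g (suc a) →
    NondecreasingFrom 1 h
  quotient-monotone 1≤a h0≡1 h1≡0 g-mono ga<ga+1 {n} = <-rec (λ n → 1 ≤ n → h n ≤ h (suc n)) go n
    where
    go : ∀ n → (∀ {m} → m < n → 1 ≤ m → h m ≤ h (suc m)) → 1 ≤ n → h n ≤ h (suc n)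
    go n ih 1≤n with n ≟ a
    ... | no n≢a  = quotient-mono-at (λ {m} 1≤m a+m≤n → ih (<-≤-trans (m<n+m m 1≤a) a+m≤n) 1≤m) n≢a (g-mono 1≤n)
    ... | yes refl = begin
      h a              ≡⟨ geomQuotient-+ʳ h=g/[1-qᵃ] 0 ⟩
      g a + h 0        ≡⟨ cong (_+_ (g a)) h0≡1 ⟩
      g a + 1          ≡⟨ +-comm (g a) 1 ⟩
      suc (g a)        ≤⟨ ga<ga+1 ⟩
      g (suc a)        ≡⟨ +-identityʳ (g (suc a)) ⟨
      g (suc a) + 0    ≡⟨ cong (_+_ (g (suc a))) h1≡0 ⟨
      g (suc a) + h 1  ≡⟨ geomQuotient-+ʳ h=g/[1-qᵃ] 1 ⟨
      h (suc a)        ∎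
      where open ≤-Reasoning

  quotient-eventually : ∀ (R : ℕ → ℕ → Set) → (∀ {x y u v} → x ≤ y → R u v → R (x + u) (y + v)) →
    ∀ {M N} → 1 ≤ a → M ≤ N → NondecreasingFrom N g →
    (∀ {n} → M ≤ n → n < N + a → R (h n) (h (suc n))) → ∀ {n} → M ≤ n → R (h n) (h (suc n))
  quotient-eventually R +-mono {M} {N} 1≤a M≤N g-mono window {n} M≤n with n <? N
  ... | yes n<N = window M≤n (<-≤-trans n<N (m≤m+n N a))
  ... | no n≮N  = periodic-induction (λ n → R (h n) (h (suc n))) N 1≤a
      (λ N≤n → window (≤-trans M≤N N≤n)) step (≮⇒≥ n≮N)
    where
    step : ∀ {n} → N ≤ n → R (h n) (h (suc n)) → R (h (a + n)) (h (suc (a + n)))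
    step {n} N≤n R-at-n = subst₂ R (sym (geomQuotient-+ h=g/[1-qᵃ] n)) (sym h-suc)
      (+-mono (subst (g (a + n) ≤_) (cong g (sym (+-suc a n))) (g-mono (≤-trans N≤n (m≤n+m n a)))) R-at-n)
      where
      h-suc : h (suc (a + n)) ≡ g (a + suc n) + h (suc n)
      h-suc = trans (cong h (sym (+-suc a n))) (geomQuotient-+ h=g/[1-qᵃ] (suc n))

-- The series pp k

from2to-suc : ∀ k → from2to (suc (suc k)) ≡ suc (suc k) ∷ from2to (suc k)
from2to-suc zero    = refl
from2to-suc (suc k) = refl

from2to-≥2 : ∀ k → All (2 ≤_) (from2to k)
from2to-≥2 zero          = []
from2to-≥2 (suc zero)    = []
from2to-≥2 (suc (suc k)) = subst (All (2 ≤_)) (sym (from2to-suc k)) (s≤s (s≤s z≤n) ∷ from2to-≥2 (suc k))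

pp-below-2 : ∀ k {n} → n < 2 → pp k n ≡ one n
pp-below-2 k n<2 = coeffProdInv-below (from2to k ++ from2to (suc k))
  (All.map (<-≤-trans n<2) (++⁺ (from2to-≥2 k) (from2to-≥2 (suc k))))

ppMid : ℕ → ℕ → ℕ
ppMid k = coeffProdInv (from2to k ++ suc (suc k) ∷ from2to (suc k))

ppMid-quotient : ∀ k → GeomQuotient (2 + k) (pp k) (ppMid k)
ppMid-quotient k = geomQuotient-insert (s≤s z≤n) (All.map (≤-trans (s≤s z≤n)) (from2to-≥2 k)) (from2to (suc k))

pp-suc-quotient : ∀ k → GeomQuotient (2 + k) (ppMid (1 + k)) (pp (2 + k))
pp-suc-quotient k = subst (λ l → GeomQuotient (2 + k) (ppMid (1 + k)) (coeffProdInv l))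
  (sym (cong₂ _++_ (from2to-suc k) (from2to-suc (suc k))))
  (geomQuotient-∷ (s≤s z≤n) (from2to (suc k) ++ 3 + k ∷ from2to (2 + k)))

ppMid-below-2 : ∀ k {n} → n < 2 → ppMid k n ≡ one n
ppMid-below-2 k n<2 = trans (geomQuotient-< (ppMid-quotient k) (≤-trans n<2 (m≤m+n 2 k))) (pp-below-2 k n<2)

pp-2 : ∀ k → pp (2 + k) 2 ≡ 2
pp-2 zero    = refl
pp-2 (suc k) = trans (geomQuotient-< (pp-suc-quotient (1 + k)) (s≤s (s≤s (s≤s z≤n))))
                     (trans (geomQuotient-< (ppMid-quotient (2 + k)) (s≤s (s≤s (s≤s z≤n)))) (pp-2 k))

≤⇒0≤- : ∀ {m n} → n ≤ m → + 0 ℤ.≤ + m - + n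
≤⇒0≤- n≤m = ℤ.i≤j⇒0≤j-i (ℤ.+≤+ n≤m)

<⇒1≤- : ∀ {m n} → n < m → + 1 ℤ.≤ + m - + n
<⇒1≤- {m} {n} n<m =
  subst (+ 1 ℤ.≤_) (sym (trans (ℤ.m-n≡m⊖n m n) (ℤ.⊖-≥ (<⇒≤ n<m)))) (ℤ.+≤+ (m<n⇒0<n∸m n<m))

1≤-⇒< : ∀ {m n} → + 1 ℤ.≤ + m - + n → n < m
1≤-⇒< 1≤m-n = ≰⇒> (λ m≤n → ℤ.<⇒≱ (ℤ.suc[i]≤j⇒i<j 1≤m-n) (ℤ.i≤j⇒i-j≤0 (ℤ.+≤+ m≤n)))

geomQuotient-+ℤ : ∀ {a c X} → GeomQuotient a c X → ∀ n → + X (a + n) ≡ + c (a + n) ℤ.+ + X n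
geomQuotient-+ℤ {c = c} {X} X=c/[1-qᵃ] n = trans (cong +_ (geomQuotient-+ X=c/[1-qᵃ] n)) (ℤ.pos-+ (c _) (X n))

-- k = 2

A₂ B₂ : ℕ → ℕ
A₂ = coeffProdInv (2 ∷ [])
B₂ = coeffProdInv (3 ∷ 2 ∷ [])

A₂-quotient : GeomQuotient 2 one A₂
A₂-quotient = geomQuotient-∷ (s≤s z≤n) []

B₂-quotient : GeomQuotient 3 A₂ B₂
B₂-quotient = geomQuotient-∷ (s≤s z≤n) (2 ∷ [])

pp₂-quotient : GeomQuotient 2 B₂ (pp 2)
pp₂-quotient = geomQuotient-∷ (s≤s z≤n) (3 ∷ 2 ∷ [])

A₂-period : ∀ j n → A₂ (j * 2 + n) ≡ A₂ n
A₂-period zero    n = refl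
A₂-period (suc j) n = trans (geomQuotient-+ A₂-quotient (j * 2 + n)) (A₂-period j n)

A₂-∣ : ∀ {n} → 2 ∣ n → A₂ n ≡ 1
A₂-∣ {n} 2∣n = trans (coeffProdInv-[ 2 ] n) (geomCoeff-∣ 2∣n)

A₂-∤ : ∀ {n} → ¬ 2 ∣ n → A₂ n ≡ 0
A₂-∤ {n} 2∤n = trans (coeffProdInv-[ 2 ] n) (geomCoeff-∤ 2∤n)

A₂-+-suc : ∀ n → A₂ n + A₂ (1 + n) ≡ 1
A₂-+-suc zero          = refl
A₂-+-suc (suc zero)    = refl
A₂-+-suc (suc (suc n)) = trans (cong₂ _+_ (A₂-period 1 n) (A₂-period 1 (1 + n))) (A₂-+-suc n)

-- (1 − q^6) f₂ = (1 − q + q^2) A₂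
f₂-period : ∀ n → f 2 (6 + n) ≡ f 2 n ℤ.+ (+ 2 ℤ.* + A₂ n - + A₂ (1 + n))
f₂-period zero    = refl
f₂-period (suc m) = begin
  + pp 2 (7 + m) - + pp 2 (6 + m)
    ≡⟨ cong₂ _-_ expand₇ expand₆ ⟩
  α (1 + m) ℤ.+ b 4 ℤ.+ (α (1 + m) ℤ.+ b 2 ℤ.+ (b 3 ℤ.+ p 1)) - (α m ℤ.+ b 3 ℤ.+ (b 4 ℤ.+ (b 2 ℤ.+ p 0)))
    ≡⟨ collect (α (1 + m)) (α m) (b 2) (b 3) (b 4) (p 0) (p 1) ⟩
  (p 1 - p 0) ℤ.+ (+ 2 ℤ.* α (1 + m) - α m)
    ≡⟨ cong (λ x → (p 1 - p 0) ℤ.+ (+ 2 ℤ.* α (1 + m) - + x)) (A₂-period 1 m) ⟨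
  f 2 (1 + m) ℤ.+ (+ 2 ℤ.* α (1 + m) - α (2 + m)) ∎
  where
  open ≡-Reasoning
  α b p : ℕ → ℤ
  α i = + A₂ i
  b i = + B₂ (i + m)
  p i = + pp 2 (i + m)
  b-step : ∀ i → + B₂ (3 + i) ≡ α (3 + i) ℤ.+ + B₂ i
  b-step = geomQuotient-+ℤ B₂-quotient
  p-step : ∀ i → + pp 2 (2 + i) ≡ + B₂ (2 + i) ℤ.+ + pp 2 i
  p-step = geomQuotient-+ℤ pp₂-quotient
  expand₇ : p 7 ≡ α (1 + m) ℤ.+ b 4 ℤ.+ (α (1 + m) ℤ.+ b 2 ℤ.+ (b 3 ℤ.+ p 1))
  expand₇ = trans (p-step (5 + m)) (cong₂ ℤ._+_
    (trans (b-step (4 + m)) (cong (λ x → + x ℤ.+ b 4) (A₂-period 3 (1 + m))))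
    (trans (p-step (3 + m)) (cong₂ ℤ._+_
      (trans (b-step (2 + m)) (cong (λ x → + x ℤ.+ b 2) (A₂-period 2 (1 + m))))
      (p-step (1 + m)))))
  expand₆ : p 6 ≡ α m ℤ.+ b 3 ℤ.+ (b 4 ℤ.+ (b 2 ℤ.+ p 0))
  expand₆ = trans (p-step (4 + m)) (cong₂ ℤ._+_
    (trans (b-step (3 + m)) (cong (λ x → + x ℤ.+ b 3) (A₂-period 3 m)))
    (trans (p-step (2 + m)) (cong (ℤ._+_ (b 4)) (p-step m))))
  collect : ∀ a₁ a₀ b₂ b₃ b₄ p₀ p₁ →
    a₁ ℤ.+ b₄ ℤ.+ (a₁ ℤ.+ b₂ ℤ.+ (b₃ ℤ.+ p₁)) - (a₀ ℤ.+ b₃ ℤ.+ (b₄ ℤ.+ (b₂ ℤ.+ p₀)))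
    ≡ (p₁ - p₀) ℤ.+ (+ 2 ℤ.* a₁ - a₀)
  collect = ℤ-solve-∀

2∣6 : 2 ∣ 6
2∣6 = divides 3 refl

f₂-period-even : ∀ {n} → 2 ∣ n → f 2 (6 + n) ≡ f 2 n ℤ.+ + 2
f₂-period-even {n} 2∣n =
  trans (f₂-period n) (cong₂ (λ x y → f 2 n ℤ.+ (+ 2 ℤ.* + x - + y)) A₂n≡1 A₂[1+n]≡0)
  where
  A₂n≡1 = A₂-∣ 2∣n
  A₂[1+n]≡0 : A₂ (1 + n) ≡ 0
  A₂[1+n]≡0 = +-cancelˡ-≡ 1 _ _ (trans (cong (_+ A₂ (1 + n)) (sym A₂n≡1)) (A₂-+-suc n))

f₂-period-odd : ∀ {n} → ¬ 2 ∣ n → f 2 (6 + n) ≡ f 2 n - + 1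
f₂-period-odd {n} 2∤n =
  trans (f₂-period n) (cong₂ (λ x y → f 2 n ℤ.+ (+ 2 ℤ.* + x - + y)) A₂n≡0 A₂[1+n]≡1)
  where
  A₂n≡0 = A₂-∤ 2∤n
  A₂[1+n]≡1 : A₂ (1 + n) ≡ 1
  A₂[1+n]≡1 = trans (cong (_+ A₂ (1 + n)) (sym A₂n≡0)) (A₂-+-suc n)

ceil/6-+6 : ∀ n → ceil/6 (6 + n) ≡ 1 + ceil/6 n
ceil/6-+6 n = m/n≡1+[m∸n]/n {6 + (n + 5)} {6} (m≤m+n 6 (n + 5))

ceil/6-pos : ∀ n → 1 ≤ ceil/6 (suc n)
ceil/6-pos n = m≥n⇒m/n>0 {suc n + 5} {6} (s≤s (m≤n+m 5 n))

ceil/6-mono : ∀ {m n} → m ≤ n → ceil/6 m ≤ ceil/6 n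
ceil/6-mono m≤n = /-monoˡ-≤ 6 (+-monoˡ-≤ 5 m≤n)

f₂-even : ∀ {n} → 2 ∣ n → + 0 ℤ.≤ f 2 n
f₂-even {n} = periodic-induction (λ n → 2 ∣ n → + 0 ℤ.≤ f 2 n) 0 (s≤s z≤n)
  (byComputation (λ n → 2 ∣? n →-dec + 0 ℤ.≤? f 2 n) 0 6)
  (λ {n} _ ih 2∣6+n → let 2∣n = ∣m+n∣m⇒∣n 2∣6+n 2∣6 in
    subst (+ 0 ℤ.≤_) (sym (f₂-period-even 2∣n)) (ℤ.+-mono-≤ (ih 2∣n) (ℤ.+≤+ z≤n)))
  z≤n

f₂-odd : ∀ {n} → ¬ 2 ∣ n → f 2 n ≡ - + ceil/6 n
f₂-odd {n} = periodic-induction (λ n → ¬ 2 ∣ n → f 2 n ≡ - + ceil/6 n) 0 (s≤s z≤n)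
  (byComputation (λ n → ¬? (2 ∣? n) →-dec f 2 n ℤ.≟ - + ceil/6 n) 0 6)
  (λ {n} _ ih 2∤6+n → let 2∤n = λ 2∣n → 2∤6+n (∣m∣n⇒∣m+n 2∣6 2∣n) in begin
    f 2 (6 + n)           ≡⟨ f₂-period-odd 2∤n ⟩
    f 2 n - + 1           ≡⟨ cong (_- + 1) (ih 2∤n) ⟩
    - + ceil/6 n - + 1    ≡⟨ -x-1≡-[1+x] (+ ceil/6 n) ⟩
    - + (1 + ceil/6 n)    ≡⟨ cong (λ c → - + c) (ceil/6-+6 n) ⟨
    - + ceil/6 (6 + n)    ∎)
  z≤n
  where
  open ≡-Reasoning
  -x-1≡-[1+x] : ∀ x → - x - + 1 ≡ - (+ 1 ℤ.+ x)
  -x-1≡-[1+x] = ℤ-solve-∀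

f₂-odd-negative : ∀ {n} → ¬ 2 ∣ n → f 2 n ℤ.≤ - + 1
f₂-odd-negative {zero}  2∤0 = ⊥-elim (2∤0 (2 ∣0))
f₂-odd-negative {suc n} 2∤n = subst (ℤ._≤ - + 1) (sym (f₂-odd 2∤n)) (ℤ.neg-mono-≤ (ℤ.+≤+ (ceil/6-pos n)))

f₂-nonneg⇔even : ∀ n → (+ 0 ℤ.≤ f 2 n) ⇔ (2 ∣ n)
f₂-nonneg⇔even n =
  mk⇔ (λ 0≤f → decidable-stable (2 ∣? n) (λ 2∤n → 0≰-1 (ℤ.≤-trans 0≤f (f₂-odd-negative 2∤n)))) f₂-even
  where
  0≰-1 : ¬ (+ 0 ℤ.≤ - + 1)
  0≰-1 ()

f₂-lower : ∀ n → - + ceil/6 n ℤ.≤ f 2 n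
f₂-lower n with 2 ∣? n
... | yes 2∣n = ℤ.≤-trans ℤ.neg-≤-pos (f₂-even 2∣n)
... | no 2∤n  = ℤ.≤-reflexive (sym (f₂-odd 2∤n))

-- k = 3

B₂-period : ∀ n → B₂ (6 + n) ≡ 1 + B₂ n
B₂-period n = begin
  B₂ (6 + n)                     ≡⟨ geomQuotient-+ B₂-quotient (3 + n) ⟩
  A₂ (6 + n) + B₂ (3 + n)        ≡⟨ cong (_+_ (A₂ (6 + n))) (geomQuotient-+ B₂-quotient n) ⟩
  A₂ (6 + n) + (A₂ (3 + n) + B₂ n) ≡⟨ +-assoc (A₂ (6 + n)) _ _ ⟨
  A₂ (6 + n) + A₂ (3 + n) + B₂ n ≡⟨ cong₂ (λ x y → x + y + B₂ n) (A₂-period 3 n) (A₂-period 1 (1 + n)) ⟩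
  A₂ n + A₂ (1 + n) + B₂ n       ≡⟨ cong (_+ B₂ n) (A₂-+-suc n) ⟩
  1 + B₂ n                       ∎
  where
  open ≡-Reasoning

B₂-≥2 : ∀ {n} → 8 ≤ n → 2 ≤ B₂ n
B₂-≥2 = periodic-induction (λ n → 2 ≤ B₂ n) 8 (s≤s z≤n) (byComputation (λ n → 2 ≤? B₂ n) 8 6)
  (λ {n} _ 2≤B → subst (2 ≤_) (sym (B₂-period n)) (m≤n⇒m≤1+n 2≤B))

pp₂-≥ : ∀ {n} → 20 ≤ n → n ≤ pp 2 n
pp₂-≥ = periodic-induction (λ n → n ≤ pp 2 n) 20 (s≤s z≤n) (byComputation (λ n → n ≤? pp 2 n) 20 2)
  (λ {n} 20≤n n≤P → subst (2 + n ≤_) (sym (geomQuotient-+ pp₂-quotient n))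
    (+-mono-≤ (B₂-≥2 (≤-trans (m≤n+m 8 12) (≤-trans 20≤n (m≤n+m n 2)))) n≤P))

Y₃ : ℕ → ℕ
Y₃ = ppMid 2

Y₃-quotient : GeomQuotient 4 (pp 2) Y₃
Y₃-quotient = ppMid-quotient 2

pp₃-quotient : GeomQuotient 3 Y₃ (pp 3)
pp₃-quotient = pp-suc-quotient 1

-- (1 − q^12) f₃ = (1 + q^3 + q^6 + q^9)(1 − q) Y₃ with (1 − q^4) Y₃ = pp₂, rewritten through f₂
D : ℕ → ℤ
D n = f 2 (13 + n) ℤ.+ f 2 (10 + n) ℤ.+ f 2 (9 + n) ℤ.+ + pp 2 (7 + n)

f₃-period : ∀ n → f 3 (13 + n) ≡ f 3 (1 + n) ℤ.+ D n
f₃-period n = begin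
  + pp 3 (13 + n) - + pp 3 (12 + n)
    ≡⟨ cong₂ _-_ (unroll (1 + n)) (unroll n) ⟩
  (y 13 ℤ.+ (y 10 ℤ.+ (y 7 ℤ.+ (y 4 ℤ.+ p₁)))) - (y 12 ℤ.+ (y 9 ℤ.+ (y 6 ℤ.+ (y 3 ℤ.+ p₀))))
    ≡⟨ regroup (y 3) (y 4) (y 5) (y 6) (y 7) (y 8) (y 9) (y 10) (y 12) (y 13) p₀ p₁ ⟩
  (p₁ - p₀) ℤ.+ ((y 13 - y 9) - (y 12 - y 8) ℤ.+ ((y 10 - y 6) - (y 9 - y 5))
                 ℤ.+ ((y 9 - y 5) - (y 8 - y 4)) ℤ.+ (y 7 - y 3))
    ≡⟨ cong (ℤ._+_ (p₁ - p₀)) (cong₂ ℤ._+_ (cong₂ ℤ._+_ (cong₂ ℤ._+_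
         (cong₂ _-_ (pp₂-as-Y (9 + n)) (pp₂-as-Y (8 + n))) (cong₂ _-_ (pp₂-as-Y (6 + n)) (pp₂-as-Y (5 + n))))
         (cong₂ _-_ (pp₂-as-Y (5 + n)) (pp₂-as-Y (4 + n)))) (pp₂-as-Y (3 + n))) ⟨
  f 3 (1 + n) ℤ.+ D n ∎
  where
  open ≡-Reasoning
  y : ℕ → ℤ
  y k = + Y₃ (k + n)
  p₀ = + pp 3 n
  p₁ = + pp 3 (1 + n)
  step : ∀ j → + pp 3 (3 + j) ≡ + Y₃ (3 + j) ℤ.+ + pp 3 j
  step = geomQuotient-+ℤ pp₃-quotient
  unroll : ∀ j → + pp 3 (12 + j) ≡ + Y₃ (12 + j) ℤ.+ (+ Y₃ (9 + j) ℤ.+ (+ Y₃ (6 + j) ℤ.+ (+ Y₃ (3 + j) ℤ.+ + pp 3 j)))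
  unroll j = trans (step (9 + j)) (cong (ℤ._+_ (+ Y₃ (12 + j))) (trans (step (6 + j))
    (cong (ℤ._+_ (+ Y₃ (9 + j))) (trans (step (3 + j)) (cong (ℤ._+_ (+ Y₃ (6 + j))) (step j))))))
  pp₂-as-Y : ∀ i → + pp 2 (4 + i) ≡ + Y₃ (4 + i) - + Y₃ i
  pp₂-as-Y i = trans (x≡x+y-y (+ pp 2 (4 + i)) (+ Y₃ i)) (cong (_- + Y₃ i) (sym (geomQuotient-+ℤ Y₃-quotient i)))
    where
    x≡x+y-y : ∀ x y → x ≡ (x ℤ.+ y) - y
    x≡x+y-y = ℤ-solve-∀
  regroup : ∀ y3 y4 y5 y6 y7 y8 y9 y10 y12 y13 p₀ p₁ →
    (y13 ℤ.+ (y10 ℤ.+ (y7 ℤ.+ (y4 ℤ.+ p₁)))) - (y12 ℤ.+ (y9 ℤ.+ (y6 ℤ.+ (y3 ℤ.+ p₀))))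
    ≡ (p₁ - p₀) ℤ.+ ((y13 - y9) - (y12 - y8) ℤ.+ ((y10 - y6) - (y9 - y5))
                     ℤ.+ ((y9 - y5) - (y8 - y4)) ℤ.+ (y7 - y3))
  regroup = ℤ-solve-∀

6+3c≤7+n : ∀ {c n} → c * 6 ≤ 18 + n → 16 ≤ n → 6 + 3 * c ≤ 7 + n
6+3c≤7+n {c} {n} 6c≤18+n 16≤n = *-cancelˡ-≤ 2 (begin
  2 * (6 + 3 * c)      ≡⟨ double-left c ⟩
  12 + c * 6           ≤⟨ +-monoʳ-≤ 12 6c≤18+n ⟩
  14 + (16 + n)        ≤⟨ +-monoʳ-≤ 14 (+-monoˡ-≤ n 16≤n) ⟩
  14 + (n + n)         ≡⟨ double-right n ⟩
  2 * (7 + n)          ∎)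
  where
  open ≤-Reasoning
  double-left : ∀ c → 2 * (6 + 3 * c) ≡ 12 + c * 6
  double-left = solve-∀
  double-right : ∀ n → 14 + (n + n) ≡ 2 * (7 + n)
  double-right = solve-∀

⌈13+n/6⌉*6≤18+n : ∀ n → ceil/6 (13 + n) * 6 ≤ 18 + n
⌈13+n/6⌉*6≤18+n n = subst (ceil/6 (13 + n) * 6 ≤_) (cong (_+_ 13) (+-comm n 5)) (m/n*n≤m (13 + n + 5) 6)

f₂-lower-mono : ∀ {m n} → m ≤ n → - + ceil/6 n ℤ.≤ f 2 m
f₂-lower-mono {m} m≤n = ℤ.≤-trans (ℤ.neg-mono-≤ (ℤ.+≤+ (ceil/6-mono m≤n))) (f₂-lower m)

D-≥6 : ∀ {n} → 16 ≤ n → + 6 ℤ.≤ D n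
D-≥6 {n} 16≤n = subst (ℤ._≤ D n) cancel
  (ℤ.+-mono-≤ (ℤ.+-mono-≤ (ℤ.+-mono-≤ (f₂-lower (13 + n)) (f₂-lower-mono (+-monoˡ-≤ n (m≤m+n 10 3))))
                          (f₂-lower-mono (+-monoˡ-≤ n (m≤m+n 9 4))))
              (ℤ.+≤+ (≤-trans (6+3c≤7+n {c} (⌈13+n/6⌉*6≤18+n n) 16≤n) (pp₂-≥ (+-monoʳ-≤ 7 (≤-trans (m≤m+n 13 3) 16≤n))))))
  where
  c = ceil/6 (13 + n)
  cancel : - + c ℤ.+ - + c ℤ.+ - + c ℤ.+ + (6 + 3 * c) ≡ + 6
  cancel = trans (cong (ℤ._+_ (- + c ℤ.+ - + c ℤ.+ - + c)) (trans (ℤ.pos-+ 6 (3 * c)) (cong (ℤ._+_ (+ 6)) (ℤ.pos-* 3 c))))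
                 (triple-cancel (+ c))
    where
    triple-cancel : ∀ x → - x ℤ.+ - x ℤ.+ - x ℤ.+ (+ 6 ℤ.+ + 3 ℤ.* x) ≡ + 6
    triple-cancel = ℤ-solve-∀

D-nonneg : ∀ {n} → 7 ≤ n → + 0 ℤ.≤ D n
D-nonneg {n} = <-split (λ n → 7 ≤ n → + 0 ℤ.≤ D n) 16
  (λ n<16 7≤n → byComputation (λ n → + 0 ℤ.≤? D n) 7 9 7≤n n<16)
  (λ m _ → ℤ.≤-trans (ℤ.+≤+ z≤n) (D-≥6 (m≤m+n 16 m)))
  n

f₃-by-period : ∀ (P : ℤ → Set) m → P (f 3 (1 + m) ℤ.+ D m) → P (f 3 (13 + m))
f₃-by-period P m = subst P (sym (f₃-period m))

f₃-pos : ∀ {n} → 8 ≤ n → + 1 ℤ.≤ f 3 n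
f₃-pos = periodic-induction (λ n → + 1 ℤ.≤ f 3 n) 8 (s≤s z≤n) base
  (λ { {suc m} (s≤s 7≤m) 1≤f → f₃-by-period (+ 1 ℤ.≤_) m (ℤ.+-mono-≤ 1≤f (D-nonneg 7≤m)) })
  where
  base : ∀ {n} → 8 ≤ n → n < 20 → + 1 ℤ.≤ f 3 n
  base {n} = <-split (λ n → 8 ≤ n → n < 20 → + 1 ℤ.≤ f 3 n) 13
    (λ n<13 8≤n _ → byComputation (λ n → + 1 ℤ.≤? f 3 n) 8 5 8≤n n<13)
    (λ m _ 13+m<20 → f₃-by-period (+ 1 ℤ.≤_) m
      (byComputation (λ m → + 1 ℤ.≤? f 3 (1 + m) ℤ.+ D m) 0 7 z≤n (+-cancelˡ-< 13 m 7 13+m<20)))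
    n

f₃-lower : ∀ {n} → 17 ≤ n → + n - + 15 ℤ.≤ + 2 ℤ.* f 3 n
f₃-lower = periodic-induction (λ n → + n - + 15 ℤ.≤ + 2 ℤ.* f 3 n) 17 (s≤s z≤n) base step
  where
  base : ∀ {n} → 17 ≤ n → n < 29 → + n - + 15 ℤ.≤ + 2 ℤ.* f 3 n
  base 17≤n = ≤-split (λ n → 17 ≤ n → n < 29 → + n - + 15 ℤ.≤ + 2 ℤ.* f 3 n) 13
    (λ m 17≤13+m 13+m<29 → f₃-by-period (λ x → + (13 + m) - + 15 ℤ.≤ + 2 ℤ.* x) m
      (byComputation (λ m → + (13 + m) - + 15 ℤ.≤? + 2 ℤ.* (f 3 (1 + m) ℤ.+ D m)) 4 12
        (+-cancelˡ-≤ 13 4 m 17≤13+m) (+-cancelˡ-< 13 m 16 13+m<29)))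
    (≤-trans (m≤m+n 13 4) 17≤n) 17≤n
  step : ∀ {n} → 17 ≤ n → + n - + 15 ℤ.≤ + 2 ℤ.* f 3 n → + (12 + n) - + 15 ℤ.≤ + 2 ℤ.* f 3 (12 + n)
  step {suc m} (s≤s 16≤m) ih = f₃-by-period (λ x → + (13 + m) - + 15 ℤ.≤ + 2 ℤ.* x) m
    (subst₂ ℤ._≤_ (sym lhs) (sym (ℤ.*-distribˡ-+ (+ 2) (f 3 (1 + m)) (D m)))
      (ℤ.+-mono-≤ ih (ℤ.*-monoˡ-≤-nonNeg (+ 2) (D-≥6 16≤m))))
    where
    lhs : + (13 + m) - + 15 ≡ (+ (1 + m) - + 15) ℤ.+ + 2 ℤ.* + 6
    lhs = trans (cong (_- + 15) (ℤ.pos-+ 12 (1 + m))) (shift12 (+ (1 + m)))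
      where
      shift12 : ∀ x → + 12 ℤ.+ x - + 15 ≡ (x - + 15) ℤ.+ + 2 ℤ.* + 6
      shift12 = ℤ-solve-∀

f₃-nonneg : ∀ {n} → 2 ≤ n → n ≢ 7 → + 0 ℤ.≤ f 3 n
f₃-nonneg {n} = <-split (λ n → 2 ≤ n → n ≢ 7 → + 0 ℤ.≤ f 3 n) 7
  (λ n<7 2≤n _ → byComputation (λ n → + 0 ℤ.≤? f 3 n) 2 5 2≤n n<7)
  (λ { zero _ 7≢7 → ⊥-elim (7≢7 refl) ; (suc m) _ _ → ℤ.≤-trans (ℤ.+≤+ z≤n) (f₃-pos (m≤m+n 8 m)) })
  n

-- k ≥ 4

ppMid-increasing : ∀ {k} → 3 ≤ k → NondecreasingFrom 1 (pp k) → IncreasingFrom 5 (pp k) →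
  NondecreasingFrom 1 (ppMid k) × (∀ {n} → 5 ≤ n → n ≢ 2 + k → ppMid k n < ppMid k (suc n))
ppMid-increasing {k} 3≤k pp-mono pp-strict =
  Y-mono , λ 5≤n n≢2+k → quotient-increasing-at Y=pp/[1-qᵏ⁺²] Y-mono n≢2+k (pp-strict 5≤n)
  where
  Y=pp/[1-qᵏ⁺²] = ppMid-quotient k
  Y-mono : NondecreasingFrom 1 (ppMid k)
  Y-mono = quotient-monotone Y=pp/[1-qᵏ⁺²] (s≤s z≤n)
    (ppMid-below-2 k (s≤s z≤n)) (ppMid-below-2 k (s≤s (s≤s z≤n))) pp-mono (pp-strict (+-monoʳ-≤ 2 3≤k))

pp-suc-increasing : ∀ {k} → 4 ≤ k → IncreasingFrom 5 (pp k) → NondecreasingFrom 1 (ppMid k) →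
  (∀ {n} → 5 ≤ n → n ≢ 2 + k → ppMid k n < ppMid k (suc n)) →
  NondecreasingFrom 1 (pp (1 + k)) × IncreasingFrom 5 (pp (1 + k))
pp-suc-increasing {k@(suc j)} 4≤k pp-strict Y-mono Y-strict = P-mono , P-strict
  where
  Y = ppMid k
  P = pp (1 + k)
  Y=pp/[1-qᵏ⁺²] = ppMid-quotient k
  P=Y/[1-qᵏ⁺¹] = pp-suc-quotient j
  5≤1+k : 5 ≤ 1 + k
  5≤1+k = s≤s 4≤k
  P-mono : NondecreasingFrom 1 P
  P-mono = quotient-monotone P=Y/[1-qᵏ⁺¹] (s≤s z≤n)
    (pp-below-2 (1 + k) (s≤s z≤n)) (pp-below-2 (1 + k) (s≤s (s≤s z≤n))) Y-mono (Y-strict 5≤1+k (1+n≢n ∘ sym))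
  P-strict : IncreasingFrom 5 P
  P-strict {n} 5≤n with n ≟ 1 + k | n ≟ 2 + k
  ... | yes refl | _ = begin-strict
    P (1 + k)                 ≡⟨ geomQuotient-+ʳ P=Y/[1-qᵏ⁺¹] 0 ⟩
    Y (1 + k) + P 0           ≡⟨ cong (_+ P 0) (geomQuotient-< Y=pp/[1-qᵏ⁺²] (n<1+n (1 + k))) ⟩
    pp k (1 + k) + P 0        <⟨ +-monoˡ-< (P 0) (pp-strict 5≤1+k) ⟩
    pp k (2 + k) + P 0        ≡⟨ cong (_+_ (pp k (2 + k))) (trans (pp-below-2 (1 + k) (s≤s z≤n)) (sym (ppMid-below-2 k (s≤s z≤n)))) ⟩
    pp k (2 + k) + Y 0        ≡⟨ geomQuotient-+ʳ Y=pp/[1-qᵏ⁺²] 0 ⟨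
    Y (2 + k)                 ≡⟨ +-identityʳ (Y (2 + k)) ⟨
    Y (2 + k) + 0             ≡⟨ cong (_+_ (Y (2 + k))) (pp-below-2 (1 + k) (s≤s (s≤s z≤n))) ⟨
    Y (2 + k) + P 1           ≡⟨ geomQuotient-+ʳ P=Y/[1-qᵏ⁺¹] 1 ⟨
    P (2 + k)                 ∎
    where open ≤-Reasoning
  ... | no _ | yes refl = begin-strict
    P (2 + k)                 ≡⟨ geomQuotient-+ʳ P=Y/[1-qᵏ⁺¹] 1 ⟩
    Y (2 + k) + P 1           <⟨ +-mono-≤-< (Y-mono (s≤s z≤n)) P1<P2 ⟩
    Y (3 + k) + P 2           ≡⟨ geomQuotient-+ʳ P=Y/[1-qᵏ⁺¹] 2 ⟨
    P (3 + k)                 ∎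
    where
    open ≤-Reasoning
    P1<P2 : P 1 < P 2
    P1<P2 = subst₂ _<_ (sym (pp-below-2 (1 + k) (s≤s (s≤s z≤n)))) (sym (pp-2 j)) (s≤s z≤n)
  ... | no n≢1+k | no n≢2+k = quotient-increasing-at P=Y/[1-qᵏ⁺¹] P-mono n≢1+k (Y-strict 5≤n n≢2+k)

pp-increasing-step : ∀ {k} → 4 ≤ k → NondecreasingFrom 1 (pp k) × IncreasingFrom 5 (pp k) →
  NondecreasingFrom 1 (pp (1 + k)) × IncreasingFrom 5 (pp (1 + k))
pp-increasing-step 4≤k (mono , strict) =
  uncurry (pp-suc-increasing 4≤k strict) (ppMid-increasing (≤-trans (n≤1+n 3) 4≤k) mono strict)

pp₃-increasing : IncreasingFrom 7 (pp 3)
pp₃-increasing 7≤n = 1≤-⇒< (f₃-pos (s≤s 7≤n))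

pp₄-increasing : NondecreasingFrom 1 (pp 4) × IncreasingFrom 5 (pp 4)
pp₄-increasing = P-mono , P-strict
  where
  Y = ppMid 3
  Y-mono : NondecreasingFrom 1 Y
  Y-mono = quotient-eventually (ppMid-quotient 3) _≤_ +-mono-≤ (s≤s z≤n) (s≤s z≤n) (<⇒≤ ∘ pp₃-increasing)
    (byComputation (λ n → Y n ≤? Y (suc n)) 1 11)
  Y-strict : IncreasingFrom 5 Y
  Y-strict = quotient-eventually (ppMid-quotient 3) _<_ +-mono-≤-< (s≤s z≤n) (m≤m+n 5 2) (<⇒≤ ∘ pp₃-increasing)
    (byComputation (λ n → Y n <? Y (suc n)) 5 7)
  P-mono : NondecreasingFrom 1 (pp 4)
  P-mono = quotient-eventually (pp-suc-quotient 2) _≤_ +-mono-≤ (s≤s z≤n) ≤-refl Y-mono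
    (byComputation (λ n → pp 4 n ≤? pp 4 (suc n)) 1 4)
  P-strict : IncreasingFrom 5 (pp 4)
  P-strict = quotient-eventually (pp-suc-quotient 2) _<_ +-mono-≤-< (s≤s z≤n) ≤-refl (Y-mono ∘ ≤-trans (s≤s z≤n))
    (byComputation (λ n → pp 4 n <? pp 4 (suc n)) 5 4)

pp-increasing : ∀ {k} → 4 ≤ k → NondecreasingFrom 1 (pp k) × IncreasingFrom 5 (pp k)
pp-increasing = ≤-split (λ k → NondecreasingFrom 1 (pp k) × IncreasingFrom 5 (pp k)) 4 go
  where
  go : ∀ j → NondecreasingFrom 1 (pp (4 + j)) × IncreasingFrom 5 (pp (4 + j))
  go zero    = pp₄-increasing
  go (suc j) = pp-increasing-step (m≤m+n 4 j) (go j)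

f-0 : ∀ k → f k 0 ≡ + 1
f-0 k = cong +_ (pp-below-2 k (s≤s z≤n))

f-1 : ∀ k → f k 1 ≡ - + 1
f-1 k = cong₂ (λ x y → + x - + y) (pp-below-2 k (s≤s (s≤s z≤n))) (pp-below-2 k (s≤s z≤n))

f-nonneg : ∀ {k} → 4 ≤ k → ∀ {n} → 2 ≤ n → + 0 ℤ.≤ f k n
f-nonneg 4≤k {suc n} (s≤s 1≤n) = ≤⇒0≤- (proj₁ (pp-increasing 4≤k) 1≤n)

f-pos : ∀ {k} → 4 ≤ k → ∀ {n} → 6 ≤ n → + 1 ℤ.≤ f k n
f-pos 4≤k {suc n} (s≤s 5≤n) = <⇒1≤- (proj₂ (pp-increasing 4≤k) 5≤n)

-- The bound of (3) holds for every n ≥ 17.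
theorem3p1 :
    ((k : ℕ) → 2 ≤ k → (f k 0 ≡ + 1) × (f k 1 ≡ - (+ 1)))
    × (((n : ℕ) → ((+ 0 ℤ.≤ f 2 n) ⇔ (2 ∣ n)))
       × ((n : ℕ) → ¬ (2 ∣ n) → f 2 n ≡ - (+ ceil/6 n)))
    × (((n : ℕ) → 2 ≤ n → n ≢ 7 → + 0 ℤ.≤ f 3 n)
       × ((n : ℕ) → ¬ (2 ∣ n) → 17 ≤ n → + n - + 15 ℤ.≤ + 2 ℤ.* f 3 n))
    × ((k : ℕ) → 4 ≤ k → ((n : ℕ) → 2 ≤ n → + 0 ℤ.≤ f k n) × (+ 1 ℤ.≤ f k (2 * k + 7)))
theorem3p1 =
  (λ k _ → f-0 k , f-1 k) ,
  (f₂-nonneg⇔even , λ _ → f₂-odd) ,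
  ((λ _ → f₃-nonneg) , λ _ _ → f₃-lower) ,
  λ k 4≤k → (λ _ → f-nonneg 4≤k) , f-pos 4≤k (≤-trans (m≤m+n 6 1) (m≤n+m 7 (2 * k)))
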